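{- Let $s_{\mathcal{D}}\in\mathcal{S}_T$ and suppose $s=s_{k_1}\circ\cdots\circ s_{k_r}$ for some segments $s_{k_1},\dots,s_{k_r}$. Then there exists $s_{k^*}\in\{s_{k_1},\dots,s_{k_r}\}$ such that $s_{k^*}\in J(s_{\mathcal{D}})$.
   Context: Let $T$ be a finite tree embedded in a disk so that exactly its leaves lie on the boundary, with every non-leaf vertex of degree at least $3$; the embedding gives a cyclic order of edges at each vertex. A segment is an acyclic path $(v_1,\dots,v_n)$, $n\ge2$, of pairwise distinct consecutive-adjacent vertices such that for each $1\le j\le n-2$ the edge $\{v_{j+1},v_{j+2}\}$ is immediately clockwise or counterclockwise from $\{v_j,v_{j+1}\}$ at $v_{j+1}$; $\mathrm{Seg}(T)$ is the set of segments. For segments $s_1=(v_1,\dots,v_k)$, $s_2=(v_k,\dots,v_n)$ sharing only $v_k$, $s_1\circ s_2=(v_1,\dots,v_n)$; they are composable if this is a segment; an iterated composition denotes concatenation in order. A split of a segment $t$ is a proper subsegment of $t$ sharing an endpoint with $t$; a break of $[a,c]$ is a pair $\{[a,b],[b,c]\}$ with $b$ a vertex of $[a,c]$ strictly between $a$ and $c$. $\mathcal{S}_T$ is the set of labels $s_{\mathcal{D}}=(s,\mathcal{D})$ with $s$ having $m$ breaks and $\mathcal{D}$ a set of $m$ splits of $s$ no two in the same break. For $s_{\mathcal{D}}\in\mathcal{S}_T$, $J(s_{\mathcal{D}}):=\{s\}\sqcup\mathcal{D}\sqcup\bigcup_{t\in\mathcal{D}}S(t)$, where $S(t)$ is the set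 of splits $s'$ of $t$ that are not splits of $s$ and not composable with any segment of $\mathcal{D}$. -}

module Defs where

open import Data.Nat using (ℕ; _≤_; _∸_)
open import Data.Fin using (Fin)
open import Data.List using (List; []; _∷_; _++_; length)
open import Data.List.Membership.Propositional using (_∈_; _∉_)
open import Data.List.Relation.Unary.Unique.Propositional using (Unique)
open import Data.List.Relation.Unary.All using (All)
open import Data.List.Relation.Unary.AllPairs using (AllPairs)
open import Data.List.Relation.Unary.Any using (Any)
open import Data.List.Relation.Unary.Linked using (Linked)
open import Data.Product using (Σ; ∃; ∃-syntax; _×_; _,_)
open import Data.Sum using (_⊎_)
open import Data.Unit using (⊤)
open import Data.Empty using (⊥)
open import Relation.Nullary using (¬_)
open import Relation.Binary.PropositionalEquality using (_≡_)

CycNext : {A : Set} → List A → A → A → Set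
CycNext {A} l a c =
  (Σ (List A) λ xs → Σ (List A) λ ys → l ≡ xs ++ a ∷ c ∷ ys)
  ⊎ (Σ (List A) λ ms → l ≡ c ∷ ms ++ a ∷ [])

CycAdj : {A : Set} → List A → A → A → Set
CycAdj l a c = CycNext l a c ⊎ CycNext l c a

-- Plane trees (combinatorial data of a tree embedded in a disk with
-- exactly its leaves on the boundary): vertices Fin n, and for every
-- vertex the list of its neighbours in cyclic (embedding) order.

record PlaneTree (n : ℕ) : Set where
  field
    nbrs : Fin n → List (Fin n)

  Adj : Fin n → Fin n → Set
  Adj u v = v ∈ nbrs u

  field
    nbrs-unique : ∀ v → Unique (nbrs v)
    irrefl      : ∀ v → v ∉ nbrs v
    symmetric   : ∀ u v → Adj u v → Adj v u
    connected   : ∀ u v → u ≡ v ⊎ (Σ (List (Fin n)) λ xs → Linked Adj (u ∷ xs ++ v ∷ []))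
    acyclic     : ∀ x y z ws → let c = x ∷ y ∷ ws ++ z ∷ [] in
                  ¬ (Unique c × Linked Adj c × Adj z x)
    degree      : ∀ v → length (nbrs v) ≡ 1 ⊎ 3 ≤ length (nbrs v)

module _ {n : ℕ} (T : PlaneTree n) where
  open PlaneTree T

  Seg : Set
  Seg = List (Fin n)

  Turns : List (Fin n) → Set
  Turns (a ∷ b ∷ c ∷ r) = CycAdj (nbrs b) a c × Turns (b ∷ c ∷ r)
  Turns _ = ⊤

  IsSegment : List (Fin n) → Set
  IsSegment l = 2 ≤ length l × Unique l × Linked Adj l × Turns l

  -- `Compose ts u` : u is the iterated concatenation t₁ ∘ ⋯ ∘ t_r of ts
  -- (consecutive pieces glued along a shared end/start vertex).
  data Compose : List Seg → Seg → Set where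
    single : ∀ t → Compose (t ∷ []) t
    glue   : ∀ p x u ts → Compose ts (x ∷ u) →
             Compose ((p ++ x ∷ []) ∷ ts) (p ++ x ∷ u)

  ComposableOrd : Seg → Seg → Set
  ComposableOrd s₁ s₂ =
    Σ Seg λ c → Compose (s₁ ∷ s₂ ∷ []) c × IsSegment c

  Composable : Seg → Seg → Set
  Composable s₁ s₂ = ComposableOrd s₁ s₂ ⊎ ComposableOrd s₂ s₁

  IsSplit : Seg → Seg → Set
  IsSplit t u = 2 ≤ length u ×
    ((Σ (Fin n) λ y → Σ Seg λ ws → t ≡ u ++ y ∷ ws)
     ⊎ (Σ (Fin n) λ y → Σ Seg λ ws → t ≡ (y ∷ ws) ++ u))

  Break : Seg → Seg → Seg → Set
  Break s p q =
    Σ (Fin n) λ x → Σ Seg λ xs → Σ (Fin n) λ b → Σ (Fin n) λ y → Σ Seg λ ys →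
      (s ≡ (x ∷ xs) ++ b ∷ y ∷ ys) × (p ≡ (x ∷ xs) ++ b ∷ []) × (q ≡ b ∷ y ∷ ys)

  SameBreak : Seg → Seg → Seg → Set
  SameBreak s d e = Σ Seg λ p → Σ Seg λ q →
    Break s p q × (d ≡ p ⊎ d ≡ q) × (e ≡ p ⊎ e ≡ q)

  -- s_𝒟 = (s , 𝒟) ∈ 𝒮_T : s a segment with m breaks (m = |s| - 2, one
  -- break per interior vertex), 𝒟 a set of m splits of s, no two in the
  -- same break (given as a list; distinct positions never share a break,
  -- which in particular forces the entries to be distinct).
  InST : Seg → List Seg → Set
  InST s 𝒟 = IsSegment s × length 𝒟 ≡ length s ∸ 2 × All (IsSplit s) 𝒟
             × AllPairs (λ d e → ¬ SameBreak s d e) 𝒟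

  InS : Seg → List Seg → Seg → Seg → Set
  InS s 𝒟 t u = IsSplit t u × ¬ IsSplit s u × All (λ d → ¬ Composable u d) 𝒟

  InJ : Seg → List Seg → Seg → Set
  InJ s 𝒟 u = u ≡ s ⊎ u ∈ 𝒟 ⊎ (Σ Seg λ t → t ∈ 𝒟 × InS s 𝒟 t u)

module Submission where

-- Let s = (v₀, …, v_{m+1}).  Its m breaks are indexed by
-- the interior vertices v₁ … v_m, and every split of s is one half of exactly
-- one break.  Since 𝒟 consists of m splits lying in pairwise different breaks,
-- a counting argument shows that 𝒟 contains exactly one half of every break.
--
-- Now walk along s = k₁ ∘ ⋯ ∘ k_r, keeping track of the part w of s not yet
-- covered; w is either s itself or a proper suffix of s lying in 𝒟.  If only
-- one piece is left, it is w ∈ J.  Otherwise the first piece ends at an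
-- interior vertex x of s.  If the suffix half [x, v_{m+1}] is in 𝒟 it becomes
-- the new w.  Otherwise the prefix half [v₀, x] is in 𝒟: then either w = s
-- and the piece is that prefix, or the piece is a split of w ∈ 𝒟 which is not
-- a split of s and is composable with no element of 𝒟, i.e. it lies in S(w).

open import Defs
open import Data.Nat using (ℕ; suc; _≤_; _<_; _∸_; z≤n; s≤s; _≟_)
open import Data.Nat.Properties
  using (≤-trans; ≤-refl; ≤∧≢⇒<; m<1+n⇒m≤n; <-irrefl; m≤m+n; m≤n+m; +-suc; suc-injective)
open import Data.Fin using (Fin)
import Data.Fin.Properties as Fin
open import Data.List using (List; []; _∷_; _++_; length; [_]; initLast; _∷ʳ′_)
open import Data.List.Properties
  using (∷-injectiveˡ; ∷-injectiveʳ; ++-assoc; length-++; ∷ʳ-++; ∷ʳ-injectiveʳ;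
         ++-cancelˡ; ++-cancelʳ; ++-conicalʳ; ≡-dec)
open import Data.List.Membership.Propositional using (_∈_)
open import Data.List.Membership.Propositional.Properties using (∈-++⁺ʳ)
import Data.List.Membership.DecPropositional as DecMembership
open import Data.List.Relation.Unary.All as All using (All; []; _∷_)
open import Data.List.Relation.Unary.AllPairs as AllPairs using (AllPairs; []; _∷_)
open import Data.List.Relation.Unary.Any using (Any; here; there)
open import Data.List.Relation.Unary.Unique.Propositional using (Unique)
open import Data.Product using (Σ; _×_; _,_; proj₁; proj₂; map₁)
open import Data.Sum using (_⊎_; inj₁; inj₂)
import Data.Sum as Sum
open import Data.Empty using (⊥; ⊥-elim)
open import Relation.Nullary using (¬_; yes; no)
open import Relation.Nullary.Decidable using (decidable-stable; _⊎-dec_)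
open import Relation.Binary.PropositionalEquality using (_≡_; _≢_; refl; sym; trans; cong; cong₂; subst)

module UniqueLists {A : Set} where

  private
    position : ∀ (P C : List A) {y B E} → Unique (P ++ y ∷ B) →
               P ++ y ∷ B ≡ C ++ y ∷ E → P ≡ C × B ≡ E
    position []      []      _         eq = refl , ∷-injectiveʳ eq
    position []      (c ∷ C) (y∉B ∷ _) eq =
      ⊥-elim (All.lookup y∉B (subst (_ ∈_) (sym (∷-injectiveʳ eq)) (∈-++⁺ʳ C (here refl))) refl)
    position (a ∷ P) []      (a∉ ∷ _)  eq = ⊥-elim (All.lookup a∉ (∈-++⁺ʳ P (here refl)) (∷-injectiveˡ eq))
    position (a ∷ P) (c ∷ C) (_ ∷ u)   eq =
      map₁ (cong₂ _∷_ (∷-injectiveˡ eq)) (position P C u (∷-injectiveʳ eq))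

  unique-position : ∀ {xs : List A} P {y B} C {E} → Unique xs →
                    xs ≡ P ++ y ∷ B → xs ≡ C ++ y ∷ E → P ≡ C × B ≡ E
  unique-position P C u refl eq = position P C u eq

  ++-cancel-length : ∀ (P C : List A) {B E} → length P ≡ length C →
                     P ++ B ≡ C ++ E → P ≡ C × B ≡ E
  ++-cancel-length []      []      _   eq = refl , eq
  ++-cancel-length (a ∷ P) (c ∷ C) len eq =
    map₁ (cong₂ _∷_ (∷-injectiveˡ eq)) (++-cancel-length P C (suc-injective len) (∷-injectiveʳ eq))

  allPairs-lookup : ∀ {R : A → A → Set} {xs a b} → AllPairs R xs →
                    a ∈ xs → b ∈ xs → a ≢ b → R a b ⊎ R b a
  allPairs-lookup (_  ∷ _)   (here refl) (here refl) a≢b = ⊥-elim (a≢b refl)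
  allPairs-lookup (Ra ∷ _)   (here refl) (there b∈) _   = inj₁ (All.lookup Ra b∈)
  allPairs-lookup (Rb ∷ _)   (there a∈)  (here refl) _  = inj₂ (All.lookup Rb a∈)
  allPairs-lookup (_  ∷ Rxs) (there a∈)  (there b∈) a≢b = allPairs-lookup Rxs a∈ b∈ a≢b

open UniqueLists

remove-top : ∀ k (xs : List ℕ) → AllPairs _≢_ xs → All (_< suc k) xs →
  Σ (List ℕ) λ ys → length xs ≤ suc (length ys) × AllPairs _≢_ ys × All (_< k) ys
                    × (∀ {Q : ℕ → Set} → All Q xs → All Q ys)
remove-top k []       _              _             = [] , z≤n , [] , [] , λ _ → []
remove-top k (x ∷ xs) (x∉xs ∷ apart) (x≤k ∷ bound) with x ≟ k
... | yes refl = xs , ≤-refl , apart , All.tabulate below , λ { (_ ∷ qs) → qs }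
  where below : ∀ {y} → y ∈ xs → y < x
        below y∈ = ≤∧≢⇒< (m<1+n⇒m≤n (All.lookup bound y∈)) (λ y≡x → All.lookup x∉xs y∈ (sym y≡x))
... | no x≢k with remove-top k xs apart bound
...   | ys , len , apart′ , bound′ , keep =
  x ∷ ys , s≤s len , keep x∉xs ∷ apart′ , ≤∧≢⇒< (m<1+n⇒m≤n x≤k) x≢k ∷ bound′ ,
  λ { (q ∷ qs) → q ∷ keep qs }

distinct-below : ∀ k (xs : List ℕ) → AllPairs _≢_ xs → All (_< k) xs → length xs ≤ k
distinct-below 0       []      _     _           = z≤n
distinct-below 0       (_ ∷ _) _     (() ∷ _)
distinct-below (suc k) xs      apart bound with remove-top k xs apart bound
... | ys , len , apart′ , bound′ , _ = ≤-trans len (s≤s (distinct-below k ys apart′ bound′))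

module SlotCounting {A : Set} (Occupies : A → ℕ → Set) where

  Placed : ℕ → A → Set
  Placed k d = Σ ℕ λ i → i < k × Occupies d i

  Apart : A → A → Set
  Apart d e = ∀ {i} → Occupies d i → ¬ Occupies e i

  every-slot-occupied : ∀ {k} (L : List A) → All (Placed k) L → AllPairs Apart L →
                        length L ≡ k → ∀ {j} → j < k → ¬ All (λ d → ¬ Occupies d j) L
  every-slot-occupied {k} L placed apart refl {j} j<k vacant =
    <-irrefl refl (subst (λ l → suc l ≤ k) (slots-length placed)
      (distinct-below k (j ∷ slots placed) (avoid placed vacant ∷ distinct placed apart) (j<k ∷ below placed)))
    where
      slots : ∀ {M} → All (Placed k) M → List ℕ
      slots = All.reduce proj₁

      slots-length : ∀ {M} (ps : All (Placed k) M) → length (slots ps) ≡ length M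
      slots-length []       = refl
      slots-length (_ ∷ ps) = cong suc (slots-length ps)

      below : ∀ {M} (ps : All (Placed k) M) → All (_< k) (slots ps)
      below []                  = []
      below ((_ , i<k , _) ∷ ps) = i<k ∷ below ps

      avoid : ∀ {M i} (ps : All (Placed k) M) → All (λ d → ¬ Occupies d i) M → All (i ≢_) (slots ps)
      avoid []                    []             = []
      avoid ((_ , _ , occ) ∷ ps) (unocc ∷ rest) = (λ { refl → unocc occ }) ∷ avoid ps rest

      distinct : ∀ {M} (ps : All (Placed k) M) → AllPairs Apart M → AllPairs _≢_ (slots ps)
      distinct []                   []               = []
      distinct ((_ , _ , occ) ∷ ps) (apart₁ ∷ apart) =
        avoid ps (All.map (λ d-apart-e → d-apart-e occ) apart₁) ∷ distinct ps apart

module Composition {n : ℕ} (T : PlaneTree n) where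

  compose-length : ∀ {ts w} → Compose T ts w → All (IsSegment T) ts → 2 ≤ length w
  compose-length (single _)            (seg ∷ [])  = proj₁ seg
  compose-length (glue p x u _ rest) (_ ∷ segs) =
    ≤-trans (compose-length rest segs) (subst (length (x ∷ u) ≤_) (sym (length-++ p)) (m≤n+m _ _))

  compose-pair : ∀ {a b c} → Compose T (a ∷ b ∷ []) c →
    Σ (List (Fin n)) λ p → Σ (Fin n) λ x → Σ (List (Fin n)) λ u → a ≡ p ++ [ x ] × b ≡ x ∷ u
  compose-pair (glue p x u _ rest) = p , x , u , refl , compose-single rest
    where
      compose-single : ∀ {t w} → Compose T (t ∷ []) w → t ≡ w
      compose-single (single _)            = refl
      compose-single (glue _ _ _ _ ())

module Labelled {n : ℕ} (T : PlaneTree n) (s : Seg T) (𝒟 : List (Seg T)) (label : InST T s 𝒟) where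
  open Composition T
  open DecMembership (≡-dec (Fin._≟_ {n})) using (_∈?_)

  s-unique : Unique s
  s-unique = proj₁ (proj₂ (proj₁ label))

  𝒟-size : length 𝒟 ≡ length s ∸ 2
  𝒟-size = proj₁ (proj₂ label)

  𝒟-splits : All (IsSplit T s) 𝒟
  𝒟-splits = proj₁ (proj₂ (proj₂ label))

  𝒟-apart : AllPairs (λ d e → ¬ SameBreak T s d e) 𝒟
  𝒟-apart = proj₂ (proj₂ (proj₂ label))

  first≢later : ∀ {h A b R} → s ≡ (h ∷ A) ++ b ∷ R → h ≢ b
  first≢later {h} {A} s≡ refl with unique-position [] (h ∷ A) s-unique s≡ s≡
  ... | () , _

  split-from-interior : ∀ {h L y R e} → s ≡ (h ∷ L) ++ y ∷ R → IsSplit T s (y ∷ e) → e ≡ R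
  split-from-interior {h} {L} s≡ (_ , inj₁ (_ , _ , s≡′)) with unique-position [] (h ∷ L) s-unique s≡′ s≡
  ... | () , _
  split-from-interior {h} {L} s≡ (_ , inj₂ (z , ws , s≡′)) =
    proj₂ (unique-position (z ∷ ws) (h ∷ L) s-unique s≡′ s≡)

  split-to-interior : ∀ {L x R p} → R ≢ [] → s ≡ L ++ x ∷ R → IsSplit T s (p ++ [ x ]) → p ≡ L
  split-to-interior {L} {x} {p = p} _ s≡ (_ , inj₁ (z , ws , s≡′)) =
    proj₁ (unique-position p L s-unique (trans s≡′ (∷ʳ-++ p x (z ∷ ws))) s≡)
  split-to-interior {L} {x} {p = p} R≢[] s≡ (_ , inj₂ (z , ws , s≡′)) =
    ⊥-elim (R≢[] (sym (proj₂ (unique-position ((z ∷ ws) ++ p) L s-unique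
                                (trans s≡′ (sym (++-assoc (z ∷ ws) p [ x ]))) s≡))))

  -- The break of s at its vertex b = v_{i+1}, with halves P = [v₀, b], Q = [b, v_{m+1}].
  BreakAt : ℕ → Seg T → Seg T → Set
  BreakAt i P Q = Σ (Fin n) λ x → Σ (Seg T) λ xs → Σ (Fin n) λ b → Σ (Fin n) λ y → Σ (Seg T) λ ys →
    (s ≡ (x ∷ xs) ++ b ∷ y ∷ ys) × (P ≡ (x ∷ xs) ++ [ b ]) × (Q ≡ b ∷ y ∷ ys) × (length xs ≡ i)

  InBreak : Seg T → ℕ → Set
  InBreak d i = Σ (Seg T) λ P → Σ (Seg T) λ Q → BreakAt i P Q × (d ≡ P ⊎ d ≡ Q)

  as-break : ∀ {i P Q} → BreakAt i P Q → Break T s P Q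
  as-break (x , xs , b , y , ys , s≡ , P≡ , Q≡ , _) = x , xs , b , y , ys , s≡ , P≡ , Q≡

  break-unique : ∀ {i P Q P′ Q′} → BreakAt i P Q → BreakAt i P′ Q′ → P ≡ P′ × Q ≡ Q′
  break-unique (x , xs , _ , _ , _ , s≡ , refl , refl , refl) (x′ , xs′ , _ , _ , _ , s≡′ , refl , refl , len)
    with ++-cancel-length (x ∷ xs) (x′ ∷ xs′) (cong suc (sym len)) (trans (sym s≡) s≡′)
  ... | refl , refl = refl , refl

  break-index-bound : ∀ {i P Q} → BreakAt i P Q → i < length s ∸ 2
  break-index-bound (x , xs , b , y , ys , s≡ , _ , _ , refl) rewrite s≡ | length-++ xs {b ∷ y ∷ ys}
    | +-suc (length xs) (suc (length ys)) | +-suc (length xs) (length ys) = s≤s (m≤m+n _ _)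

  split-in-break : ∀ {d} → IsSplit T s d → Σ ℕ λ i → i < length s ∸ 2 × InBreak d i
  split-in-break {[]}        (() , _)
  split-in-break {_ ∷ []}    (s≤s () , _)
  split-in-break {x ∷ e} (_ , inj₁ (y , ws , s≡)) with initLast e
  split-in-break {x ∷ .[]} (s≤s () , _) | []
  ... | xs ∷ʳ′ b = length xs , break-index-bound br , _ , _ , br , inj₁ refl
    where br : BreakAt (length xs) ((x ∷ xs) ++ [ b ]) (b ∷ y ∷ ws)
          br = x , xs , b , y , ws , trans s≡ (∷ʳ-++ (x ∷ xs) b (y ∷ ws)) , refl , refl , refl
  split-in-break {b ∷ c ∷ e} (_ , inj₂ (y , ws , s≡)) = length ws , break-index-bound br , _ , _ , br , inj₂ refl
    where br : BreakAt (length ws) ((y ∷ ws) ++ [ b ]) (b ∷ c ∷ e)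
          br = y , ws , b , c , e , s≡ , refl , refl , refl

  same-break : ∀ {d e i} → InBreak d i → InBreak e i → SameBreak T s d e
  same-break (P , Q , br , d-half) (_ , _ , br′ , e-half) with break-unique br br′
  ... | refl , refl = P , Q , as-break br , d-half , e-half

  -- 𝒟 contains a half of every break (counting: |𝒟| splits in distinct breaks).
  halves-cover : ∀ h A b c B → s ≡ (h ∷ A) ++ b ∷ c ∷ B → (h ∷ A) ++ [ b ] ∈ 𝒟 ⊎ b ∷ c ∷ B ∈ 𝒟
  halves-cover h A b c B s≡ =
    decidable-stable (P ∈? 𝒟 ⊎-dec Q ∈? 𝒟) λ neither →
      every-slot-occupied 𝒟 (All.map split-in-break 𝒟-splits)
        (AllPairs.map (λ ¬same {_} d-in e-in → ¬same (same-break d-in e-in)) 𝒟-apart)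
        𝒟-size (break-index-bound br) (All.tabulate (missing neither))
    where
      open SlotCounting InBreak
      P Q : Seg T
      P = (h ∷ A) ++ [ b ]
      Q = b ∷ c ∷ B
      br : BreakAt (length A) P Q
      br = h , A , b , c , B , s≡ , refl , refl , refl
      missing : ¬ (P ∈ 𝒟 ⊎ Q ∈ 𝒟) → ∀ {d} → d ∈ 𝒟 → ¬ InBreak d (length A)
      missing neither d∈ (_ , _ , br′ , d-half) with break-unique br′ br
      ... | refl , refl = neither (Sum.map (λ d≡P → subst (_∈ 𝒟) d≡P d∈) (λ d≡Q → subst (_∈ 𝒟) d≡Q d∈) d-half)

  not-both-halves : ∀ {h A b R} → s ≡ (h ∷ A) ++ b ∷ R → (h ∷ A) ++ [ b ] ∈ 𝒟 → b ∷ R ∈ 𝒟 → ⊥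
  not-both-halves {R = []} _ _ Q∈ with proj₁ (All.lookup 𝒟-splits Q∈)
  ... | s≤s ()
  not-both-halves {h} {A} {b} {c ∷ B} s≡ P∈ Q∈
    with allPairs-lookup 𝒟-apart P∈ Q∈ (λ P≡Q → first≢later s≡ (∷-injectiveˡ P≡Q))
  ... | inj₁ ¬same = ¬same (_ , _ , br , inj₁ refl , inj₂ refl)
    where br = h , A , b , c , B , s≡ , refl , refl
  ... | inj₂ ¬same = ¬same (_ , _ , br , inj₂ refl , inj₁ refl)
    where br = h , A , b , c , B , s≡ , refl , refl

  no-split-from : ∀ {h A x R e} → s ≡ (h ∷ A) ++ x ∷ R → (h ∷ A) ++ [ x ] ∈ 𝒟 → x ∷ e ∈ 𝒟 → ⊥
  no-split-from s≡ P∈ d∈ with split-from-interior s≡ (All.lookup 𝒟-splits d∈)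
  ... | refl = not-both-halves s≡ P∈ d∈

  no-split-into : ∀ {h A x R p} → R ≢ [] → s ≡ (h ∷ A) ++ x ∷ R → x ∷ R ∈ 𝒟 → p ++ [ x ] ∈ 𝒟 → ⊥
  no-split-into {h} {A} R≢[] s≡ Q∈ d∈ with split-to-interior {L = h ∷ A} R≢[] s≡ (All.lookup 𝒟-splits d∈)
  ... | refl = not-both-halves s≡ d∈ Q∈

  piece-in-S : ∀ {h A q p x z u h′ A′} →
    s ≡ (h ∷ A) ++ (q ∷ p) ++ x ∷ z ∷ u → (q ∷ p) ++ x ∷ z ∷ u ∈ 𝒟 →
    s ≡ (h′ ∷ A′) ++ x ∷ z ∷ u → (h′ ∷ A′) ++ [ x ] ∈ 𝒟 →
    2 ≤ length ((q ∷ p) ++ [ x ]) → InS T s 𝒟 ((q ∷ p) ++ x ∷ z ∷ u) ((q ∷ p) ++ [ x ])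
  piece-in-S {h} {A} {q} {p} {x} {z} {u} s≡ w∈ s≡′ P∈ len =
    (len , inj₁ (z , u , sym (∷ʳ-++ (q ∷ p) x (z ∷ u)))) , not-split , All.tabulate not-composable
    where
      k : Seg T
      k = (q ∷ p) ++ [ x ]

      -- k starts at the interior vertex q but stops before the end of s.
      not-split : ¬ IsSplit T s k
      not-split k-split with ∷-injectiveʳ (++-cancelˡ p [ x ] (x ∷ z ∷ u) (split-from-interior s≡ k-split))
      ... | ()

      tail-nonempty : p ++ x ∷ z ∷ u ≢ []
      tail-nonempty tail≡[] with ++-conicalʳ p (x ∷ z ∷ u) tail≡[]
      ... | ()

      -- k ∘ d would start d at x, and d ∘ k would end d at q.
      not-composable : ∀ {d} → d ∈ 𝒟 → ¬ Composable T k d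
      not-composable d∈ (inj₁ (_ , k∘d , _)) with compose-pair k∘d
      ... | p₀ , x₀ , u₀ , k≡ , refl with ∷ʳ-injectiveʳ (q ∷ p) p₀ k≡
      ...   | refl = no-split-from s≡′ P∈ d∈
      not-composable d∈ (inj₂ (_ , d∘k , _)) with compose-pair d∘k
      ... | p₀ , x₀ , u₀ , refl , k≡ with ∷-injectiveˡ k≡
      ...   | refl = no-split-into tail-nonempty s≡ w∈ d∈

  -- The part of s not yet covered by the pieces: s itself, or a proper suffix of
  -- s belonging to 𝒟.
  Remaining : Seg T → Set
  Remaining w = w ≡ s ⊎ (Σ (Fin n) λ h → Σ (Seg T) λ A → s ≡ (h ∷ A) ++ w × w ∈ 𝒟)

  remaining-in-J : ∀ {w} → Remaining w → InJ T s 𝒟 w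
  remaining-in-J (inj₁ w≡s)              = inj₁ w≡s
  remaining-in-J (inj₂ (_ , _ , _ , w∈)) = inj₂ (inj₁ w∈)

  remaining-prefix : ∀ {q p x v} → Remaining ((q ∷ p) ++ x ∷ v) →
                     Σ (Fin n) λ h → Σ (Seg T) λ A → s ≡ (h ∷ A) ++ x ∷ v
  remaining-prefix {q} {p} (inj₁ w≡s) = q , p , sym w≡s
  remaining-prefix {q} {p} {x} {v} (inj₂ (h , A , s≡ , _)) =
    h , A ++ q ∷ p , trans s≡ (sym (++-assoc (h ∷ A) (q ∷ p) (x ∷ v)))

  first-piece-in-J : ∀ {q p x z u h A} → Remaining ((q ∷ p) ++ x ∷ z ∷ u) →
    s ≡ (h ∷ A) ++ x ∷ z ∷ u → (h ∷ A) ++ [ x ] ∈ 𝒟 →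
    2 ≤ length ((q ∷ p) ++ [ x ]) → InJ T s 𝒟 ((q ∷ p) ++ [ x ])
  first-piece-in-J {q} {p} {x} {z} {u} {h} {A} (inj₁ w≡s) s≡ P∈ _ =
    inj₂ (inj₁ (subst (λ P → P ++ [ x ] ∈ 𝒟) (sym prefix≡) P∈))
    where prefix≡ : q ∷ p ≡ h ∷ A
          prefix≡ = ++-cancelʳ (x ∷ z ∷ u) (q ∷ p) (h ∷ A) (trans w≡s s≡)
  first-piece-in-J (inj₂ (_ , _ , s≡′ , w∈)) s≡ P∈ len =
    inj₂ (inj₂ (_ , w∈ , piece-in-S s≡′ w∈ s≡ P∈ len))

  walk : ∀ {ks w} → Compose T ks w → All (IsSegment T) ks → Remaining w → Any (InJ T s 𝒟) ks
  walk (single _)                    _             rem = here (remaining-in-J rem)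
  walk (glue [] _ _ _ _)             ((s≤s () , _) ∷ _) _
  walk (glue (_ ∷ _) _ [] _ rest)    (_ ∷ segs)   _ with compose-length rest segs
  ... | s≤s ()
  walk (glue (q ∷ p) x (z ∷ u) _ rest) (seg ∷ segs) rem with remaining-prefix rem
  ... | h , A , s≡ with halves-cover h A x z u s≡
  ...   | inj₁ P∈ = here (first-piece-in-J rem s≡ P∈ (proj₁ seg))
  ...   | inj₂ Q∈ = there (walk rest segs (inj₂ (h , A , s≡ , Q∈)))

lemma5p11 : {n : ℕ} (T : PlaneTree n) (s : Seg T) (𝒟 : List (Seg T)) →
    InST T s 𝒟 →
    (ks : List (Seg T)) → All (IsSegment T) ks → Compose T ks s →
    Any (InJ T s 𝒟) ks
lemma5p11 T s 𝒟 label ks segs s≡∘ks = Labelled.walk T s 𝒟 label s≡∘ks segs (inj₁ refl)
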